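{- Let $k\geq 1$, $n=8k+7$, $G=C(n,\pm\{1,2,3,4\})$, $\ell\in\{0,1,\dots,k\}$, and let \[A=(\{1,2\},\{4k+2,4k+3\},\{4k+4,4k+5\},\{4(k+\ell)+j: j\in\{7,8,9\}\})\] (indices mod $n$) be an $S$-cluster for some $S\subseteq V(G)$. If $X\subseteq V(G)\setminus\{2,6,\dots,2+4\ell\}$ resolves $A$, then $|X|\geq 3$.
   Context: $C(n,\pm\{1,2,3,4\})$ is the graph on $\mathbb{Z}_n$ where distinct $i,j$ are adjacent iff $j-i\equiv\pm s\pmod n$ for some $s\in\{1,2,3,4\}$; $d$ is graph distance, and $r(v|X)=(d(v,x))_{x\in X}$. For $S\subseteq V$, a set $B$ is an $S$-block if $r(a|S)=r(b|S)$ for all $a,b\in B$. A tuple $(A_1,\dots,A_p)$ of $S$-blocks is an $S$-cluster if the $A_i$ are contained in distinct equivalence classes of $u\sim_S v\iff r(u|S)=r(v|S)$. A set $X$ resolves a tuple $(A_1,\dots,A_p)$ if $r(a|X)\neq r(b|X)$ for all distinct $a,b$ in the same $A_j$. -}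

module Defs where

open import Data.Nat using (ℕ; zero; suc; _+_; _*_; _≤_; NonZero)
open import Data.Nat.DivMod using (_%_; m%n<n)
open import Data.Fin using (Fin; toℕ; fromℕ<)
import Data.Fin
open import Data.Fin.Subset using (Subset; _∈_)
open import Data.List using (List)
import Data.List.Membership.Propositional as L
open import Data.Product using (_×_; ∃)
open import Data.Sum using (_⊎_)
open import Relation.Binary.PropositionalEquality using (_≡_; _≢_)
open import Relation.Nullary using (¬_)

module _ (n : ℕ) .{{_ : NonZero n}} where

  vtx : ℕ → Fin n
  vtx m = fromℕ< (m%n<n m n)

  data Gen : ℕ → Set where
    g1 : Gen 1
    g2 : Gen 2
    g3 : Gen 3
    g4 : Gen 4

  Adj : Fin n → Fin n → Set
  Adj i j = i ≢ j × ∃ λ s → Gen s ×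
              (toℕ j ≡ (toℕ i + s) % n ⊎ toℕ i ≡ (toℕ j + s) % n)

  data Walk : Fin n → Fin n → ℕ → Set where
    here : ∀ {i} → Walk i i 0
    step : ∀ {i j l m} → Adj i j → Walk j l m → Walk i l (suc m)

  IsDist : Fin n → Fin n → ℕ → Set
  IsDist i j m = Walk i j m × (∀ m' → Walk i j m' → m ≤ m')

  SameRep : Subset n → Fin n → Fin n → Set
  SameRep X a b = ∀ x → x ∈ X → ∀ m → (IsDist a x m → IsDist b x m) × (IsDist b x m → IsDist a x m)

  IsBlock : Subset n → List (Fin n) → Set
  IsBlock S B = ∀ a b → a L.∈ B → b L.∈ B → SameRep S a b

  IsCluster : ∀ {p} → Subset n → (Fin p → List (Fin n)) → Set
  IsCluster S A = (∀ i → IsBlock S (A i)) ×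
    (∀ i j → i ≢ j → ∀ a b → a L.∈ A i → b L.∈ A j → ¬ SameRep S a b)

  Resolves : ∀ {p} → Subset n → (Fin p → List (Fin n)) → Set
  Resolves X A = ∀ j a b → a L.∈ A j → b L.∈ A j → a ≢ b → ¬ SameRep X a b

-- n = 8k+7, written 7 + 8 * k so that it reduces to a successor
N : ℕ → ℕ
N k = 7 + 8 * k

open import Data.List using (_∷_; [])

clusterA : (k ℓ : ℕ) → Fin 4 → List (Fin (N k))
clusterA k ℓ Data.Fin.zero = vtx (N k) 1 ∷ vtx (N k) 2 ∷ []

clusterA k ℓ (Data.Fin.suc Data.Fin.zero) = vtx (N k) (4 * k + 2) ∷ vtx (N k) (4 * k + 3) ∷ []
clusterA k ℓ (Data.Fin.suc (Data.Fin.suc Data.Fin.zero)) = vtx (N k) (4 * k + 4) ∷ vtx (N k) (4 * k + 5) ∷ []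
clusterA k ℓ (Data.Fin.suc (Data.Fin.suc (Data.Fin.suc Data.Fin.zero))) =
  vtx (N k) (4 * (k + ℓ) + 7) ∷ vtx (N k) (4 * (k + ℓ) + 8) ∷ vtx (N k) (4 * (k + ℓ) + 9) ∷ []

-- In C(n, ±{1,2,3,4}) the distance between two vertices at cyclic gap c is ⌈c/4⌉.  For n = 8k+7
-- this means a vertex x at offset δ = x − (a+1) mod n distinguishes a from a+1 only when
-- δ = 4q with q ≤ k, or δ = 2 + 4q with q > k; in every other case a walk of the same length reaches
-- x from a and from a+1, and the ℤ-valued displacement of a walk shows none is shorter.  Applied to
-- the consecutive pairs (1,2), (4k+2,4k+3), (4k+4,4k+5) and (4(k+ℓ)+7, 4(k+ℓ)+8) of the cluster,
-- this confines the vertices resolving each pair to explicit unions of residue classes mod 4.  The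
-- classes for the second and third pairs are disjoint from each other and from those of the first
-- pair, except that the first two share the vertices 2 + 4q with q ≤ k.  So X contains three
-- distinct resolvers unless one vertex 2 + 4q resolves both of the first two pairs; the hypothesis
-- on X forces q > ℓ, hence ℓ < k, and then a resolver of the fourth pair is a new third vertex.
-- Since 3 ≤ ∣ X ∣ is decidable, the argument runs in the double-negation monad, which lets the
-- resolvers be chosen without searching for them.

module Submission where

open import Defs
open import Data.Nat using (ℕ; zero; suc; _≤_; _<_; _*_; _+_; _∸_; z≤n; s≤s; NonZero; _<?_; _≤?_)
open import Data.Nat.Properties
open import Data.Nat.DivMod
open import Data.Fin using (Fin; toℕ) renaming (zero to fzero; suc to fsuc)
open import Data.Fin.Properties using (toℕ-injective; toℕ-fromℕ<; toℕ<n) renaming (_≟_ to _≟ᶠ_)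
open import Data.Fin.Subset using (Subset; _∈_; _∉_; ∣_∣)
open import Data.Fin.Subset.Properties using (x∈p⇒∣p-x∣<∣p∣; x∈p∧x≢y⇒x∈p-y)
open import Data.List.Relation.Unary.Any using (here; there)
import Data.List.Membership.Propositional as List
open import Data.Product using (∃; _×_; _,_; proj₁; proj₂)
open import Data.Sum using (_⊎_; inj₁; inj₂)
import Data.Sum as Sum
open import Data.Empty using (⊥; ⊥-elim)
open import Data.Unit using (tt) -- the instance solving the True (r <? 4) side conditions of mod4-unique
open import Effect.Monad using (RawMonad)
open import Function using (case_of_)
open import Level using (0ℓ)
open import Relation.Nullary using (¬_; yes; no)
open import Relation.Nullary.Decidable using (True; toWitness; decidable-stable)
open import Relation.Nullary.Negation using (¬¬-Monad; ¬¬-map)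
open import Relation.Binary.PropositionalEquality
import Data.Integer as ℤ
open ℤ using (ℤ; +_; -[1+_])
import Data.Integer.Properties as ℤ
import Data.Integer.Tactic.RingSolver as ℤ-Solver
import Data.Nat.Tactic.RingSolver as ℕ-Solver

gen-≥1 : ∀ {n s} .{{_ : NonZero n}} → Gen n s → 1 ≤ s
gen-≥1 g1 = s≤s z≤n
gen-≥1 g2 = s≤s z≤n
gen-≥1 g3 = s≤s z≤n
gen-≥1 g4 = s≤s z≤n

gen-≤4 : ∀ {n s} .{{_ : NonZero n}} → Gen n s → s ≤ 4
gen-≤4 g1 = s≤s z≤n
gen-≤4 g2 = s≤s (s≤s z≤n)
gen-≤4 g3 = s≤s (s≤s (s≤s z≤n))
gen-≤4 g4 = ≤-refl

module Circulant (n : ℕ) .{{_ : NonZero n}} where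

  v : ℕ → Fin n
  v = vtx n

  toℕ-v : ∀ m → toℕ (v m) ≡ m % n
  toℕ-v m = toℕ-fromℕ< _

  toℕ-v-< : ∀ {m} → m < n → toℕ (v m) ≡ m
  toℕ-v-< {m} m<n = trans (toℕ-v m) (m<n⇒m%n≡m m<n)

  v-+n : ∀ m → v (m + n) ≡ v m
  v-+n m = toℕ-injective (trans (toℕ-v (m + n)) (trans ([m+n]%n≡m%n m n) (sym (toℕ-v m))))

  v-toℕ : ∀ x → v (toℕ x) ≡ x
  v-toℕ x = toℕ-injective (toℕ-v-< (toℕ<n x))

  -- m names x when m ≡ x mod n and m < 2n, so that offsets from a vertex need not be reduced.
  _Names_ : ℕ → Fin n → Set
  m Names x = toℕ x ≡ m ⊎ toℕ x + n ≡ m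

  Names⇒v≡ : ∀ {m x} → m Names x → v m ≡ x
  Names⇒v≡ {x = x} (inj₁ refl) = v-toℕ x
  Names⇒v≡ {x = x} (inj₂ refl) = trans (v-+n (toℕ x)) (v-toℕ x)

  v-Names : ∀ {m} → m < n + n → m Names v m
  v-Names {m} m<2n with m <? n
  ... | yes m<n = inj₁ (toℕ-v-< m<n)
  ... | no m≮n = inj₂ (begin
      toℕ (v m) + n        ≡⟨ cong (_+ n) (toℕ-v m) ⟩
      m % n + n            ≡⟨ cong (λ t → t % n + n) (sym (m∸n+n≡m n≤m)) ⟩
      (m ∸ n + n) % n + n  ≡⟨ cong (_+ n) ([m+n]%n≡m%n (m ∸ n) n) ⟩
      (m ∸ n) % n + n      ≡⟨ cong (_+ n) (m<n⇒m%n≡m (+-cancelʳ-< n (m ∸ n) n m∸n+n<2n)) ⟩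
      m ∸ n + n            ≡⟨ m∸n+n≡m n≤m ⟩
      m                    ∎)
    where
    open ≡-Reasoning
    n≤m = ≮⇒≥ m≮n
    m∸n+n<2n : m ∸ n + n < n + n
    m∸n+n<2n = subst (_< n + n) (sym (m∸n+n≡m n≤m)) m<2n

  [r+s]%n≢r : ∀ r s → r < n → 0 < s → s < n → (r + s) % n ≢ r
  [r+s]%n≢r r s r<n 0<s s<n eq with v-Names (+-mono-< r<n s<n)
  ... | inj₁ e = <⇒≢ (m<m+n r 0<s) (sym (trans (sym e) (trans (toℕ-v (r + s)) eq)))
  ... | inj₂ e = >⇒≢ s<n (+-cancelˡ-≡ r n s (trans (cong (_+ n) (sym (trans (toℕ-v (r + s)) eq))) e))

  v-+-adj : ∀ m {s} → Gen n s → s < n → Adj n (v m) (v (m + s))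
  v-+-adj m {s} g s<n = v≢ , s , g , inj₁ toℕ-v-+
    where
    toℕ-v-+ : toℕ (v (m + s)) ≡ (toℕ (v m) + s) % n
    toℕ-v-+ = begin
      toℕ (v (m + s))           ≡⟨ toℕ-v (m + s) ⟩
      (m + s) % n               ≡⟨ %-distribˡ-+ m s n ⟩
      (m % n + s % n) % n       ≡⟨ cong (λ t → (m % n + t) % n) (m<n⇒m%n≡m s<n) ⟩
      (m % n + s) % n           ≡⟨ cong (λ t → (t + s) % n) (toℕ-v m) ⟨
      (toℕ (v m) + s) % n       ∎
      where open ≡-Reasoning
    v≢ : v m ≢ v (m + s)
    v≢ eq = [r+s]%n≢r (toℕ (v m)) s (toℕ<n (v m)) (gen-≥1 g) s<n
              (trans (sym toℕ-v-+) (cong toℕ (sym eq)))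

  adj-sym : ∀ {i j} → Adj n i j → Adj n j i
  adj-sym (i≢j , s , g , inj₁ e) = (λ eq → i≢j (sym eq)) , s , g , inj₂ e
  adj-sym (i≢j , s , g , inj₂ e) = (λ eq → i≢j (sym eq)) , s , g , inj₁ e

  _++ʷ_ : ∀ {i j l a b} → Walk n i j a → Walk n j l b → Walk n i l (a + b)
  here ++ʷ w = w
  step e w ++ʷ w' = step e (w ++ʷ w')

  reverseʷ : ∀ {i j m} → Walk n i j m → Walk n j i m
  reverseʷ here = here
  reverseʷ {m = suc m} (step e w) =
    subst (Walk n _ _) (+-comm m 1) (reverseʷ w ++ʷ step (adj-sym e) here)

  -- Distances are bounded below by tracking positions in ℤ: a step moves j − i by at most 4 modulo n.
  CloseMod : ℕ → ℕ → ℕ → Set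
  CloseMod i j c = ∃ λ (z : ℤ) → ℤ.∣ (+ j ℤ.- + i) ℤ.- z ℤ.* + n ∣ ≤ c

  close-refl : ∀ i → CloseMod i i 0
  close-refl i = + 0 , ≤-reflexive (cong ℤ.∣_∣ (identity (+ i) (+ n)))
    where
    identity : ∀ a b → (a ℤ.- a) ℤ.- + 0 ℤ.* b ≡ + 0
    identity = ℤ-Solver.solve-∀

  close-trans : ∀ {i j l c c'} → CloseMod i j c → CloseMod j l c' → CloseMod i l (c + c')
  close-trans {i} {j} {l} (z , p) (z' , p') = z ℤ.+ z' ,
    ≤-trans (≤-reflexive (cong ℤ.∣_∣ (split (+ i) (+ j) (+ l) z z' (+ n))))
      (≤-trans (ℤ.∣i+j∣≤∣i∣+∣j∣ ((+ j ℤ.- + i) ℤ.- z ℤ.* + n) ((+ l ℤ.- + j) ℤ.- z' ℤ.* + n))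
               (+-mono-≤ p p'))
    where
    split : ∀ i j l z z' n → (l ℤ.- i) ℤ.- (z ℤ.+ z') ℤ.* n
                           ≡ ((j ℤ.- i) ℤ.- z ℤ.* n) ℤ.+ ((l ℤ.- j) ℤ.- z' ℤ.* n)
    split = ℤ-Solver.solve-∀

  close-sym : ∀ {i j c} → CloseMod i j c → CloseMod j i c
  close-sym {i} {j} (z , p) = ℤ.- z ,
    ≤-trans (≤-reflexive (trans (cong ℤ.∣_∣ (negate (+ i) (+ j) z (+ n)))
                                (ℤ.∣-i∣≡∣i∣ ((+ j ℤ.- + i) ℤ.- z ℤ.* + n)))) p
    where
    negate : ∀ i j z n → (i ℤ.- j) ℤ.- (ℤ.- z) ℤ.* n ≡ ℤ.- ((j ℤ.- i) ℤ.- z ℤ.* n)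
    negate = ℤ-Solver.solve-∀

  %-close : ∀ a b s → a ≡ (b + s) % n → CloseMod b a s
  %-close a b s a≡ = ℤ.- (+ q) , ≤-reflexive (cong ℤ.∣_∣ (begin
      (+ a ℤ.- + b) ℤ.- ℤ.- (+ q) ℤ.* + n    ≡⟨ rearrange (+ a) (+ b) (+ q) (+ n) ⟩
      (+ a ℤ.+ + q ℤ.* + n) ℤ.- + b          ≡⟨ cong (λ t → (+ a ℤ.+ t) ℤ.- + b) (ℤ.pos-* q n) ⟨
      (+ a ℤ.+ + (q * n)) ℤ.- + b            ≡⟨ cong (ℤ._- + b) (ℤ.pos-+ a (q * n)) ⟨
      + (a + q * n) ℤ.- + b                  ≡⟨ cong (λ t → + t ℤ.- + b) division ⟨
      + (b + s) ℤ.- + b                      ≡⟨ cong (ℤ._- + b) (ℤ.pos-+ b s) ⟩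
      (+ b ℤ.+ + s) ℤ.- + b                  ≡⟨ cancel (+ b) (+ s) ⟩
      + s                                    ∎))
    where
    open ≡-Reasoning
    q = (b + s) / n
    division : b + s ≡ a + q * n
    division = trans (m≡m%n+[m/n]*n (b + s) n) (cong (_+ q * n) (sym a≡))
    rearrange : ∀ a b q n → (a ℤ.- b) ℤ.- ℤ.- q ℤ.* n ≡ (a ℤ.+ q ℤ.* n) ℤ.- b
    rearrange = ℤ-Solver.solve-∀
    cancel : ∀ b s → (b ℤ.+ s) ℤ.- b ≡ s
    cancel = ℤ-Solver.solve-∀

  adj⇒close : ∀ {x y} → Adj n x y → CloseMod (toℕ x) (toℕ y) 4
  adj⇒close {x} {y} (_ , s , g , inj₁ e) =
    let z , p = %-close (toℕ y) (toℕ x) s e in z , ≤-trans p (gen-≤4 g)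
  adj⇒close {x} {y} (_ , s , g , inj₂ e) =
    let z , p = close-sym {toℕ y} {toℕ x} (%-close (toℕ x) (toℕ y) s e) in z , ≤-trans p (gen-≤4 g)

  walk⇒close : ∀ {x y m} → Walk n x y m → CloseMod (toℕ x) (toℕ y) (m * 4)
  walk⇒close {x} here = close-refl (toℕ x)
  walk⇒close {x} {y} {suc m} (step {j = j} e w) =
    close-trans {toℕ x} {toℕ j} {toℕ y} {4} {m * 4} (adj⇒close e) (walk⇒close w)

  -- a multiple of n is either ≤ 0 or ≥ n, so it moves d ∈ [0, n] by at least min(d, n − d)
  ∣d-zn∣-bound : ∀ d z → d ≤ n → d ≤ ℤ.∣ + d ℤ.- z ℤ.* + n ∣ ⊎ n ∸ d ≤ ℤ.∣ + d ℤ.- z ℤ.* + n ∣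
  ∣d-zn∣-bound d (+ zero) _ = inj₁ (≤-reflexive (cong ℤ.∣_∣ (sym (minus-0 (+ d) (+ n)))))
    where
    minus-0 : ∀ d n → d ℤ.- + 0 ℤ.* n ≡ d
    minus-0 = ℤ-Solver.solve-∀
  ∣d-zn∣-bound d (+ suc t) d≤n = inj₂ (begin
      n ∸ d                            ≤⟨ ∸-monoˡ-≤ d (m≤m+n n (t * n)) ⟩
      suc t * n ∸ d                    ≡⟨ ℤ.∣⊖∣-≤ d≤zn ⟨
      ℤ.∣ d ℤ.⊖ suc t * n ∣             ≡⟨ cong ℤ.∣_∣ (ℤ.m-n≡m⊖n d (suc t * n)) ⟨
      ℤ.∣ + d ℤ.- + (suc t * n) ∣      ≡⟨ cong (λ w → ℤ.∣ + d ℤ.- w ∣) (ℤ.pos-* (suc t) n) ⟩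
      ℤ.∣ + d ℤ.- + suc t ℤ.* + n ∣    ∎)
    where
    open ≤-Reasoning
    d≤zn : d ≤ suc t * n
    d≤zn = ≤-trans d≤n (m≤m+n n (t * n))
  ∣d-zn∣-bound d -[1+ t ] _ = inj₁ (begin
      d                                ≤⟨ m≤m+n d (suc t * n) ⟩
      d + suc t * n                    ≡⟨ cong ℤ.∣_∣ (ℤ.pos-+ d (suc t * n)) ⟩
      ℤ.∣ + d ℤ.+ + (suc t * n) ∣      ≡⟨ cong (λ w → ℤ.∣ + d ℤ.+ w ∣) (ℤ.pos-* (suc t) n) ⟩
      ℤ.∣ + d ℤ.+ + suc t ℤ.* + n ∣    ≡⟨ cong ℤ.∣_∣ (minus-neg (+ d) (+ suc t) (+ n)) ⟨
      ℤ.∣ + d ℤ.- -[1+ t ] ℤ.* + n ∣   ∎)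
    where
    open ≤-Reasoning
    minus-neg : ∀ d s n → d ℤ.- (ℤ.- s) ℤ.* n ≡ d ℤ.+ s ℤ.* n
    minus-neg = ℤ-Solver.solve-∀

  close⇒offset-bound : ∀ {x y : Fin n} {c} d → (toℕ x + d) Names y → d ≤ n →
                       CloseMod (toℕ x) (toℕ y) c → d ≤ c ⊎ n ∸ d ≤ c
  close⇒offset-bound {x} {y} {c} d y≡ d≤n (z , p) =
    let z' , p' = offset y≡ in Sum.map (λ h → ≤-trans h p') (λ h → ≤-trans h p') (∣d-zn∣-bound d z' d≤n)
    where
    X = + toℕ x
    Y = + toℕ y
    shift : ∀ x d z n → ((x ℤ.+ d) ℤ.- x) ℤ.- z ℤ.* n ≡ d ℤ.- z ℤ.* n
    shift = ℤ-Solver.solve-∀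
    unwrap : ∀ y x z n → (y ℤ.- x) ℤ.- z ℤ.* n ≡ ((y ℤ.+ n) ℤ.- x) ℤ.- (z ℤ.+ + 1) ℤ.* n
    unwrap = ℤ-Solver.solve-∀
    offset : (toℕ x + d) Names y → ∃ λ z' → ℤ.∣ + d ℤ.- z' ℤ.* + n ∣ ≤ c
    offset (inj₁ e) = z , subst (_≤ c) (cong ℤ.∣_∣ (begin
        (Y ℤ.- X) ℤ.- z ℤ.* + n              ≡⟨ cong (λ t → (t ℤ.- X) ℤ.- z ℤ.* + n) Y≡X+d ⟩
        ((X ℤ.+ + d) ℤ.- X) ℤ.- z ℤ.* + n    ≡⟨ shift X (+ d) z (+ n) ⟩
        + d ℤ.- z ℤ.* + n                    ∎)) p
      where
      open ≡-Reasoning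
      Y≡X+d : Y ≡ X ℤ.+ + d
      Y≡X+d = trans (cong +_ e) (ℤ.pos-+ (toℕ x) d)
    offset (inj₂ e) = z ℤ.+ + 1 , subst (_≤ c) (cong ℤ.∣_∣ (begin
        (Y ℤ.- X) ℤ.- z ℤ.* + n                         ≡⟨ unwrap Y X z (+ n) ⟩
        ((Y ℤ.+ + n) ℤ.- X) ℤ.- (z ℤ.+ + 1) ℤ.* + n     ≡⟨ cong (λ t → (t ℤ.- X) ℤ.- (z ℤ.+ + 1) ℤ.* + n) Y+n≡X+d ⟩
        ((X ℤ.+ + d) ℤ.- X) ℤ.- (z ℤ.+ + 1) ℤ.* + n     ≡⟨ shift X (+ d) (z ℤ.+ + 1) (+ n) ⟩
        + d ℤ.- (z ℤ.+ + 1) ℤ.* + n                     ∎)) p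
      where
      open ≡-Reasoning
      Y+n≡X+d : Y ℤ.+ + n ≡ X ℤ.+ + d
      Y+n≡X+d = trans (sym (ℤ.pos-+ (toℕ y) n)) (trans (cong +_ e) (ℤ.pos-+ (toℕ x) d))

  walk-length-> : ∀ {x y : Fin n} {m} d q → (toℕ x + d) Names y → d ≤ n →
                  q * 4 < d → q * 4 < n ∸ d → Walk n x y m → q < m
  walk-length-> {m = m} d q y≡ d≤n q4<d q4<n∸d w with close⇒offset-bound d y≡ d≤n (walk⇒close w)
  ... | inj₁ d≤4m = *-cancelʳ-< 4 q m (<-≤-trans q4<d d≤4m)
  ... | inj₂ n∸d≤4m = *-cancelʳ-< 4 q m (<-≤-trans q4<n∸d n∸d≤4m)

  Equidistant : Fin n → Fin n → Fin n → Set
  Equidistant a b x = ∃ λ D → IsDist n a x D × IsDist n b x D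

  Names-from-v : ∀ {a δ x} → a < n → (a + δ) Names x → (toℕ (v a) + δ) Names x
  Names-from-v {a} {δ} {x} a<n = subst (λ t → (t + δ) Names x) (sym (toℕ-v-< a<n))

  Names-from-v-pred : ∀ {a δ x} → suc a < n → (suc a + δ) Names x → (toℕ (v a) + suc δ) Names x
  Names-from-v-pred {a} {δ} {x} a+1<n x≡ =
    Names-from-v (<-trans (n<1+n a) a+1<n) (subst (_Names x) (sym (+-suc a δ)) x≡)

  module _ (4<n : 4 < n) where

    forward-walk : ∀ m q {r} → Gen n r → Walk n (v m) (v (m + (r + q * 4))) (suc q)
    forward-walk m zero {r} g =
      subst (λ t → Walk n (v m) (v (m + t)) 1) (sym (+-identityʳ r))
        (step (v-+-adj m g (≤-<-trans (gen-≤4 g) 4<n)) here)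
    forward-walk m (suc q) {r} g =
      step (v-+-adj m g4 4<n)
        (subst (λ t → Walk n (v (m + 4)) (v t) (suc q)) (reassoc m r q) (forward-walk (m + 4) q g))
      where
      reassoc : ∀ m r q → m + 4 + (r + q * 4) ≡ m + (r + suc q * 4)
      reassoc = ℕ-Solver.solve-∀

    -- Forward walks of q + 1 steps reach x from both a and a+1, and the gap from either side exceeds 4q.
    equidistant-ahead : ∀ a {x} q {r} → Gen n r → Gen n (suc r) → suc a < n →
                        (suc a + (r + q * 4)) Names x → suc (r + q * 4) + suc (q * 4) ≤ n →
                        Equidistant (v a) (v (suc a)) x
    equidistant-ahead a {x} q {r} g g' a+1<n x≡ room =
      suc q , (walk-from-a , shortest-from-a) , (walk-from-a+1 , shortest-from-a+1)
      where
      δ = r + q * 4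
      q*4<δ : q * 4 < δ
      q*4<δ = +-monoˡ-≤ (q * 4) (gen-≥1 g)
      q*4<n∸1+δ : q * 4 < n ∸ suc δ
      q*4<n∸1+δ = m+n≤o⇒m≤o∸n (suc (q * 4)) (subst (_≤ n) (+-comm (suc δ) _) room)
      1+δ≤n : suc δ ≤ n
      1+δ≤n = m+n≤o⇒m≤o (suc δ) room
      walk-from-a+1 : Walk n (v (suc a)) x (suc q)
      walk-from-a+1 = subst (λ t → Walk n (v (suc a)) t (suc q)) (Names⇒v≡ x≡) (forward-walk (suc a) q g)
      walk-from-a : Walk n (v a) x (suc q)
      walk-from-a = subst (λ t → Walk n (v a) t (suc q)) (trans (cong v (+-suc a δ)) (Names⇒v≡ x≡))
                      (forward-walk a q g')
      shortest-from-a+1 : ∀ m → Walk n (v (suc a)) x m → suc q ≤ m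
      shortest-from-a+1 m = walk-length-> δ q (Names-from-v a+1<n x≡) (<⇒≤ 1+δ≤n) q*4<δ
                              (<-≤-trans q*4<n∸1+δ (∸-monoʳ-≤ n (n≤1+n δ)))
      shortest-from-a : ∀ m → Walk n (v a) x m → suc q ≤ m
      shortest-from-a m = walk-length-> (suc δ) q (Names-from-v-pred a+1<n x≡) 1+δ≤n
                            (<-trans q*4<δ (n<1+n δ)) q*4<n∸1+δ

    -- x lies just behind a: forward walks of i + 1 steps from x wrap around to both a and a+1.
    equidistant-behind : ∀ a {x} δ i {r} → Gen n r → Gen n (suc r) → suc a < n →
                         (suc a + δ) Names x → δ + suc (r + i * 4) ≡ n → i * 4 < δ →
                         Equidistant (v a) (v (suc a)) x
    equidistant-behind a {x} δ i {r} g g' a+1<n x≡ δ+gap≡n i*4<δ =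
      suc i , (reverseʷ (walk-to a g (trans (reassoc a δ e) (unwrap a)) (v-+n a)) , shortest-from-a)
            , (reverseʷ (walk-to (suc a) g' (trans (reassoc' a δ e) (unwrap (suc a))) (v-+n (suc a))) , shortest-from-a+1)
      where
      e = r + i * 4
      reassoc : ∀ a δ e → suc a + δ + e ≡ a + (δ + suc e)
      reassoc = ℕ-Solver.solve-∀
      reassoc' : ∀ a δ e → suc a + δ + suc e ≡ suc a + (δ + suc e)
      reassoc' = ℕ-Solver.solve-∀
      unwrap : ∀ b → b + (δ + suc e) ≡ b + n
      unwrap b = cong (λ t → b + t) δ+gap≡n
      walk-to : ∀ b {s} → Gen n s → suc a + δ + (s + i * 4) ≡ b + n → v (b + n) ≡ v b → Walk n x (v b) (suc i)
      walk-to b {s} gs eq wrap = subst₂ (λ t u → Walk n t u (suc i)) (Names⇒v≡ x≡) (trans (cong v eq) wrap)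
                                   (forward-walk (suc a + δ) i gs)
      n∸δ≡ : n ∸ δ ≡ suc e
      n∸δ≡ = trans (cong (_∸ δ) (sym δ+gap≡n)) (m+n∸m≡n δ (suc e))
      1+δ+e≡n : suc δ + e ≡ n
      1+δ+e≡n = trans (sym (+-suc δ e)) δ+gap≡n
      n∸1+δ≡ : n ∸ suc δ ≡ e
      n∸1+δ≡ = trans (cong (_∸ suc δ) (sym 1+δ+e≡n)) (m+n∸m≡n (suc δ) e)
      shortest-from-a+1 : ∀ m → Walk n (v (suc a)) x m → suc i ≤ m
      shortest-from-a+1 m = walk-length-> δ i (Names-from-v a+1<n x≡)
                              (m+n≤o⇒m≤o δ (≤-reflexive δ+gap≡n)) i*4<δ
                              (subst (i * 4 <_) (sym n∸δ≡) (s≤s (m≤n+m (i * 4) r)))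
      shortest-from-a : ∀ m → Walk n (v a) x m → suc i ≤ m
      shortest-from-a m = walk-length-> (suc δ) i (Names-from-v-pred a+1<n x≡)
                            (m+n≤o⇒m≤o (suc δ) (≤-reflexive 1+δ+e≡n)) (<-trans i*4<δ (n<1+n δ))
                            (subst (i * 4 <_) (sym n∸1+δ≡) (+-monoˡ-≤ (i * 4) (gen-≥1 g)))

  offset-Names : ∀ a x → a < n → ∃ λ δ → δ < n × (a + δ) Names x
  offset-Names a x a<n with a ≤? toℕ x
  ... | yes a≤x = toℕ x ∸ a , ≤-<-trans (m∸n≤m (toℕ x) a) (toℕ<n x) , inj₁ (sym (m+[n∸m]≡n a≤x))
  ... | no a≰x = toℕ x + n ∸ a , δ<n , inj₂ (sym (m+[n∸m]≡n a≤x+n))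
    where
    a≤x+n : a ≤ toℕ x + n
    a≤x+n = ≤-trans (<⇒≤ a<n) (m≤n+m n (toℕ x))
    δ<n : toℕ x + n ∸ a < n
    δ<n = +-cancelʳ-< a _ n (subst (_< n + a) (sym (m∸n+n≡m a≤x+n))
            (subst (toℕ x + n <_) (+-comm a n) (+-monoˡ-< n (≰⇒> a≰x))))

  IsDist-unique : ∀ {y x m D} → IsDist n y x m → IsDist n y x D → m ≡ D
  IsDist-unique (w , shortest) (w' , shortest') = ≤-antisym (shortest _ w') (shortest' _ w)

  equidistant⇒SameRep : ∀ X a b → (∀ x → x ∈ X → Equidistant a b x) → SameRep n X a b
  equidistant⇒SameRep X a b equi x x∈X m with equi x x∈X
  ... | D , da , db = (λ d → subst (IsDist n b x) (sym (IsDist-unique d da)) db)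
                    , (λ d → subst (IsDist n a x) (sym (IsDist-unique d db)) da)

  v≢v-suc : ∀ {a} → suc a < n → v a ≢ v (suc a)
  v≢v-suc {a} a+1<n eq = <-irrefl (begin
    a              ≡⟨ toℕ-v-< (<-trans (n<1+n a) a+1<n) ⟨
    toℕ (v a)      ≡⟨ cong toℕ eq ⟩
    toℕ (v (suc a)) ≡⟨ toℕ-v-< a+1<n ⟩
    suc a          ∎) (n<1+n a)
    where open ≡-Reasoning

data Mod4View : ℕ → Set where
  mod4≡0 : ∀ q → Mod4View (q * 4)
  mod4≡1 : ∀ q → Mod4View (1 + q * 4)
  mod4≡2 : ∀ q → Mod4View (2 + q * 4)
  mod4≡3 : ∀ q → Mod4View (3 + q * 4)

mod4-view : ∀ d → Mod4View d
mod4-view zero = mod4≡0 0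
mod4-view (suc d) with mod4-view d
... | mod4≡0 q = mod4≡1 q
... | mod4≡1 q = mod4≡2 q
... | mod4≡2 q = mod4≡3 q
... | mod4≡3 q = mod4≡0 (suc q)

mod4-unique : ∀ r r' a b → {{True (r <? 4)}} → {{True (r' <? 4)}} →
              r + a * 4 ≡ r' + b * 4 → r ≡ r' × a ≡ b
mod4-unique r r' a b {{r<4}} {{r'<4}} eq =
  r≡r' , *-cancelʳ-≡ a b 4 (+-cancelˡ-≡ r _ _ (trans eq (cong (_+ b * 4) (sym r≡r'))))
  where
  r≡r' : r ≡ r'
  r≡r' = begin
    r                   ≡⟨ m<n⇒m%n≡m (toWitness r<4) ⟨
    r % 4               ≡⟨ [m+kn]%n≡m%n r a 4 ⟨
    (r + a * 4) % 4     ≡⟨ cong (_% 4) eq ⟩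
    (r' + b * 4) % 4    ≡⟨ [m+kn]%n≡m%n r' b 4 ⟩
    r' % 4              ≡⟨ m<n⇒m%n≡m (toWitness r'<4) ⟩
    r'                  ∎
    where open ≡-Reasoning

<-witness : ∀ {a b} w → suc a + w ≡ b → a < b
<-witness {a} w refl = m≤m+n (suc a) w

≤-witness : ∀ {a b} w → a + w ≡ b → a ≤ b
≤-witness {a} w refl = m≤m+n a w

4<N : ∀ k → 4 < N k
4<N k = <-witness (2 + 8 * k) refl

-- The offsets δ = x − (a+1) mod n at which x can tell a from a+1 in C(8k+7, ±{1,2,3,4}).
data Separating (k : ℕ) : ℕ → Set where
  ahead  : ∀ {q} → q ≤ k → Separating k (q * 4)
  behind : ∀ {q} → k < q → Separating k (2 + q * 4)

ahead-room : ∀ k q {r} → r ≤ 3 → q ≤ k → suc (r + q * 4) + suc (q * 4) ≤ N k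
ahead-room k q {r} r≤3 q≤k with m≤n⇒∃[o]m+o≡n q≤k
... | i , refl = ≤-trans (+-monoˡ-≤ (suc (q * 4)) (s≤s (+-monoˡ-≤ (q * 4) r≤3)))
                         (≤-witness (2 + 8 * i) (identity q i))
  where
  identity : ∀ q i → suc (3 + q * 4) + suc (q * 4) + (2 + 8 * i) ≡ 7 + 8 * (q + i)
  identity = ℕ-Solver.solve-∀

r+[1+k+j]*4<N⇒j≤k : ∀ k j r → r + (suc k + j) * 4 < N k → j ≤ k
r+[1+k+j]*4<N⇒j≤k k j r lt = ≮⇒≥ λ k<j → <-asym lt (begin-strict
  N k                     <⟨ <-witness 0 (identity k) ⟩
  (suc k + suc k) * 4     ≤⟨ *-monoˡ-≤ 4 (+-monoʳ-≤ (suc k) k<j) ⟩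
  (suc k + j) * 4         ≤⟨ m≤n+m _ r ⟩
  r + (suc k + j) * 4     ∎)
  where
  open ≤-Reasoning
  identity : ∀ k → suc (7 + 8 * k) + 0 ≡ (suc k + suc k) * 4
  identity = ℕ-Solver.solve-∀

3+[1+k+j]*4<N⇒j<k : ∀ k j → 3 + (suc k + j) * 4 < N k → j < k
3+[1+k+j]*4<N⇒j<k k j lt = ≰⇒> λ k≤j → <-irrefl refl (begin-strict
  N k                     ≡⟨ identity k ⟩
  3 + (suc k + k) * 4     ≤⟨ +-monoʳ-≤ 3 (*-monoˡ-≤ 4 (+-monoʳ-≤ (suc k) k≤j)) ⟩
  3 + (suc k + j) * 4     <⟨ lt ⟩
  N k                     ∎)
  where
  open ≤-Reasoning
  identity : ∀ k → 7 + 8 * k ≡ 3 + (suc k + k) * 4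
  identity = ℕ-Solver.solve-∀

behind-gap₀ : ∀ k q → k < q → q * 4 < N k → ∃ λ i → q * 4 + suc (2 + i * 4) ≡ N k × i * 4 < q * 4
behind-gap₀ k q k<q δ<n with m≤n⇒∃[o]m+o≡n k<q
... | j , refl with m≤n⇒∃[o]m+o≡n (r+[1+k+j]*4<N⇒j≤k k j 0 δ<n)
...   | i , refl = i , gap j i , <-witness (3 + 8 * j) (bound j i)
  where
  gap : ∀ j i → (suc (j + i) + j) * 4 + suc (2 + i * 4) ≡ 7 + 8 * (j + i)
  gap = ℕ-Solver.solve-∀
  bound : ∀ j i → suc (i * 4) + (3 + 8 * j) ≡ (suc (j + i) + j) * 4
  bound = ℕ-Solver.solve-∀

behind-gap₁ : ∀ k q → k < q → 1 + q * 4 < N k → ∃ λ i → (1 + q * 4) + suc (1 + i * 4) ≡ N k × i * 4 < 1 + q * 4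
behind-gap₁ k q k<q δ<n with m≤n⇒∃[o]m+o≡n k<q
... | j , refl with m≤n⇒∃[o]m+o≡n (r+[1+k+j]*4<N⇒j≤k k j 1 δ<n)
...   | i , refl = i , gap j i , <-witness (4 + 8 * j) (bound j i)
  where
  gap : ∀ j i → (1 + (suc (j + i) + j) * 4) + suc (1 + i * 4) ≡ 7 + 8 * (j + i)
  gap = ℕ-Solver.solve-∀
  bound : ∀ j i → suc (i * 4) + (4 + 8 * j) ≡ 1 + (suc (j + i) + j) * 4
  bound = ℕ-Solver.solve-∀

behind-gap₃ : ∀ k q → k < q → 3 + q * 4 < N k → ∃ λ i → (3 + q * 4) + suc (3 + i * 4) ≡ N k × i * 4 < 3 + q * 4
behind-gap₃ k q k<q δ<n with m≤n⇒∃[o]m+o≡n k<q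
... | j , refl with m≤n⇒∃[o]m+o≡n (3+[1+k+j]*4<N⇒j<k k j δ<n)
...   | i , refl = i , gap j i , <-witness (10 + 8 * j) (bound j i)
  where
  gap : ∀ j i → (3 + (suc (suc j + i) + j) * 4) + suc (3 + i * 4) ≡ 7 + 8 * (suc j + i)
  gap = ℕ-Solver.solve-∀
  bound : ∀ j i → suc (i * 4) + (10 + 8 * j) ≡ 3 + (suc (suc j + i) + j) * 4
  bound = ℕ-Solver.solve-∀

module _ (k : ℕ) where
  open Circulant (N k)

  separating⊎equidistant : ∀ a {x} δ → suc a < N k → δ < N k → (suc a + δ) Names x →
                           Separating k δ ⊎ Equidistant (v a) (v (suc a)) x
  separating⊎equidistant a δ a+1<n δ<n x≡ with mod4-view δ
  ... | mod4≡0 q with ≤-<-connex q k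
  ...   | inj₁ q≤k = inj₁ (ahead q≤k)
  ...   | inj₂ k<q = let i , gap , i*4<δ = behind-gap₀ k q k<q δ<n in
                     inj₂ (equidistant-behind (4<N k) a _ i g2 g3 a+1<n x≡ gap i*4<δ)
  separating⊎equidistant a δ a+1<n δ<n x≡ | mod4≡1 q with ≤-<-connex q k
  ...   | inj₁ q≤k = inj₂ (equidistant-ahead (4<N k) a q g1 g2 a+1<n x≡ (ahead-room k q (s≤s z≤n) q≤k))
  ...   | inj₂ k<q = let i , gap , i*4<δ = behind-gap₁ k q k<q δ<n in
                     inj₂ (equidistant-behind (4<N k) a _ i g1 g2 a+1<n x≡ gap i*4<δ)
  separating⊎equidistant a δ a+1<n δ<n x≡ | mod4≡2 q with ≤-<-connex q k
  ...   | inj₁ q≤k = inj₂ (equidistant-ahead (4<N k) a q g2 g3 a+1<n x≡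
                              (ahead-room k q (s≤s (s≤s z≤n)) q≤k))
  ...   | inj₂ k<q = inj₁ (behind k<q)
  separating⊎equidistant a δ a+1<n δ<n x≡ | mod4≡3 q with ≤-<-connex q k
  ...   | inj₁ q≤k = inj₂ (equidistant-ahead (4<N k) a q g3 g4 a+1<n x≡
                              (ahead-room k q (s≤s (s≤s (s≤s z≤n))) q≤k))
  ...   | inj₂ k<q = let i , gap , i*4<δ = behind-gap₃ k q k<q δ<n in
                     inj₂ (equidistant-behind (4<N k) a _ i g3 g4 a+1<n x≡ gap i*4<δ)

  Separator : Subset (N k) → ℕ → Set
  Separator X a = ∃ λ x → x ∈ X × ∃ λ δ → δ < N k × (suc a + δ) Names x × Separating k δ

  separator : ∀ X a → suc a < N k → ¬ SameRep (N k) X (v a) (v (suc a)) → ¬ ¬ Separator X a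
  separator X a a+1<n a≁a+1 none = a≁a+1 (equidistant⇒SameRep X (v a) (v (suc a)) equidistant)
    where
    equidistant : ∀ x → x ∈ X → Equidistant (v a) (v (suc a)) x
    equidistant x x∈X with offset-Names (suc a) x a+1<n
    ... | δ , δ<n , x≡ with separating⊎equidistant a δ a+1<n δ<n x≡
    ...   | inj₁ sep = ⊥-elim (none (x , x∈X , δ , δ<n , x≡ , sep))
    ...   | inj₂ equi = equi

-- N k = 3 + (1 + 2k) * 4, so adding N k shifts the residue mod 4 by 3
data WrapView (k : ℕ) : ℕ → Set where
  wrap0 : ∀ t → t * 4 + N k ≡ 3 + (t + (1 + 2 * k)) * 4 → WrapView k (t * 4)
  wrap1 : ∀ t → (1 + t * 4) + N k ≡ 0 + (t + (2 + 2 * k)) * 4 → WrapView k (1 + t * 4)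
  wrap2 : ∀ t → (2 + t * 4) + N k ≡ 1 + (t + (2 + 2 * k)) * 4 → WrapView k (2 + t * 4)
  wrap3 : ∀ t → (3 + t * 4) + N k ≡ 2 + (t + (2 + 2 * k)) * 4 → WrapView k (3 + t * 4)

wrap-view : ∀ k u → WrapView k u
wrap-view k u with mod4-view u
... | mod4≡0 t = wrap0 t (identity k t)
  where
  identity : ∀ k t → t * 4 + (7 + 8 * k) ≡ 3 + (t + (1 + 2 * k)) * 4
  identity = ℕ-Solver.solve-∀
... | mod4≡1 t = wrap1 t (identity k t)
  where
  identity : ∀ k t → (1 + t * 4) + (7 + 8 * k) ≡ 0 + (t + (2 + 2 * k)) * 4
  identity = ℕ-Solver.solve-∀
... | mod4≡2 t = wrap2 t (identity k t)
  where
  identity : ∀ k t → (2 + t * 4) + (7 + 8 * k) ≡ 1 + (t + (2 + 2 * k)) * 4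
  identity = ℕ-Solver.solve-∀
... | mod4≡3 t = wrap3 t (identity k t)
  where
  identity : ∀ k t → (3 + t * 4) + (7 + 8 * k) ≡ 2 + (t + (2 + 2 * k)) * 4
  identity = ℕ-Solver.solve-∀

u+N≢c : ∀ u k c → c < N k → u + N k ≢ c
u+N≢c u k c c<N eq = <-irrefl refl (≤-<-trans (≤-trans (m≤n+m (N k) u) (≤-reflexive eq)) c<N)

u≢N+c : ∀ u k c → u < N k → u ≢ N k + c
u≢N+c u k c u<N eq = <-irrefl refl (<-≤-trans u<N (≤-trans (m≤m+n (N k) c) (≤-reflexive (sym eq))))

2+q*4<N⇒q≤1+2k : ∀ k q → 2 + q * 4 < N k → q ≤ 1 + 2 * k
2+q*4<N⇒q≤1+2k k q δ<N = ≮⇒≥ λ 1+2k<q → <-irrefl refl (<-≤-trans δ<N (begin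
  N k                          ≤⟨ ≤-witness 3 (identity k) ⟩
  2 + (suc (1 + 2 * k)) * 4    ≤⟨ +-monoʳ-≤ 2 (*-monoˡ-≤ 4 1+2k<q) ⟩
  2 + q * 4                    ∎))
  where
  open ≤-Reasoning
  identity : ∀ k → 7 + 8 * k + 3 ≡ 2 + (suc (1 + 2 * k)) * 4
  identity = ℕ-Solver.solve-∀

-- positions of the vertices separating the pairs (1,2), (4k+2,4k+3), (4k+4,4k+5) and (4(k+ℓ)+7,4(k+ℓ)+8)
Sep₁ : ℕ → ℕ → Set
Sep₁ k u = u ≡ 1 ⊎ (∃ λ q → u ≡ 2 + q * 4 × q ≤ k) ⊎ (∃ λ q → u ≡ q * 4 × suc (suc k) ≤ q)

Sep₂ : ℕ → Set
Sep₂ u = (∃ λ q → u ≡ 2 + q * 4) ⊎ (∃ λ q → u ≡ 3 + q * 4)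

Sep₃ : ℕ → ℕ → Set
Sep₃ k u = (∃ λ q → u ≡ q * 4 × q ≤ suc k) ⊎ (∃ λ q → u ≡ 1 + q * 4 × suc k ≤ q)

Sep₄ : ℕ → ℕ → ℕ → Set
Sep₄ k ℓ u = (∃ λ q → u ≡ q * 4 × suc (suc k) ≤ q) ⊎ (∃ λ q → u ≡ 1 + q * 4 × q ≤ ℓ)
           ⊎ (∃ λ q → u ≡ 3 + q * 4)

separating⇒Sep₁ : ∀ k u δ → δ < N k → (u ≡ 2 + δ ⊎ u + N k ≡ 2 + δ) → Separating k δ → Sep₁ k u
separating⇒Sep₁ k u _ _ (inj₁ e) (ahead {q} q≤k) = inj₂ (inj₁ (q , e , q≤k))
separating⇒Sep₁ k u _ _ (inj₁ e) (behind {q} k<q) = inj₂ (inj₂ (suc q , e , s≤s k<q))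
separating⇒Sep₁ k u _ _ (inj₂ e) (ahead {q} q≤k) with m≤n⇒∃[o]m+o≡n q≤k
... | i , refl = ⊥-elim (u+N≢c u (q + i) (2 + q * 4) (<-witness (4 + q * 4 + 8 * i) (identity q i)) e)
  where
  identity : ∀ q i → suc (2 + q * 4) + (4 + q * 4 + 8 * i) ≡ 7 + 8 * (q + i)
  identity = ℕ-Solver.solve-∀
separating⇒Sep₁ k u _ δ<N (inj₂ e) (behind {q} _) = from-wrap u (wrap-view k u) e
  where
  from-wrap : ∀ u → WrapView k u → u + N k ≡ 0 + suc q * 4 → Sep₁ k u
  from-wrap _ (wrap0 t e₀) e with () ← proj₁ (mod4-unique 3 0 (t + (1 + 2 * k)) (suc q) (trans (sym e₀) e))
  from-wrap _ (wrap2 t e₀) e with () ← proj₁ (mod4-unique 1 0 (t + (2 + 2 * k)) (suc q) (trans (sym e₀) e))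
  from-wrap _ (wrap3 t e₀) e with () ← proj₁ (mod4-unique 2 0 (t + (2 + 2 * k)) (suc q) (trans (sym e₀) e))
  from-wrap _ (wrap1 t e₀) e = subst (λ t → Sep₁ k (1 + t * 4)) (sym t≡0) (inj₁ refl)
    where
    t+2+2k≡1+q : t + (2 + 2 * k) ≡ suc q
    t+2+2k≡1+q = proj₂ (mod4-unique 0 0 (t + (2 + 2 * k)) (suc q) (trans (sym e₀) e))
    t≡0 : t ≡ 0
    t≡0 = n≤0⇒n≡0 (+-cancelʳ-≤ (2 + 2 * k) t 0
                     (≤-trans (≤-reflexive t+2+2k≡1+q) (s≤s (2+q*4<N⇒q≤1+2k k q δ<N))))

separating⇒Sep₂ : ∀ k u δ → u < N k → (u ≡ suc (4 * k + 2) + δ ⊎ u + N k ≡ suc (4 * k + 2) + δ) →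
                  Separating k δ → Sep₂ u
separating⇒Sep₂ k u _ _ (inj₁ e) (ahead {q} _) = inj₂ (k + q , trans e (identity k q))
  where
  identity : ∀ k q → suc (4 * k + 2) + q * 4 ≡ 3 + (k + q) * 4
  identity = ℕ-Solver.solve-∀
separating⇒Sep₂ k u _ u<N (inj₁ e) (behind {q} k<q) with m≤n⇒∃[o]m+o≡n k<q
... | j , refl = ⊥-elim (u≢N+c u k (2 + j * 4) u<N (trans e (identity k j)))
  where
  identity : ∀ k j → suc (4 * k + 2) + (2 + (suc k + j) * 4) ≡ 7 + 8 * k + (2 + j * 4)
  identity = ℕ-Solver.solve-∀
separating⇒Sep₂ k u _ _ (inj₂ e) (ahead {q} q≤k) with m≤n⇒∃[o]m+o≡n q≤k
... | i , refl = ⊥-elim (u+N≢c u (q + i) _ (<-witness (3 + 4 * i) (identity q i)) e)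
  where
  identity : ∀ q i → suc (suc (4 * (q + i) + 2) + q * 4) + (3 + 4 * i) ≡ 7 + 8 * (q + i)
  identity = ℕ-Solver.solve-∀
separating⇒Sep₂ k u _ _ (inj₂ e) (behind {q} _) = from-wrap u (wrap-view k u) (trans e (identity k q))
  where
  identity : ∀ k q → suc (4 * k + 2) + (2 + q * 4) ≡ 1 + (k + suc q) * 4
  identity = ℕ-Solver.solve-∀
  M = k + suc q
  from-wrap : ∀ u → WrapView k u → u + N k ≡ 1 + M * 4 → Sep₂ u
  from-wrap _ (wrap0 t e₀) e with () ← proj₁ (mod4-unique 3 1 (t + (1 + 2 * k)) M (trans (sym e₀) e))
  from-wrap _ (wrap1 t e₀) e with () ← proj₁ (mod4-unique 0 1 (t + (2 + 2 * k)) M (trans (sym e₀) e))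
  from-wrap _ (wrap3 t e₀) e with () ← proj₁ (mod4-unique 2 1 (t + (2 + 2 * k)) M (trans (sym e₀) e))
  from-wrap _ (wrap2 t e₀) e = inj₁ (t , refl)

separating⇒Sep₃ : ∀ k u δ → u < N k → δ < N k → (u ≡ suc (4 * k + 4) + δ ⊎ u + N k ≡ suc (4 * k + 4) + δ) →
                  Separating k δ → Sep₃ k u
separating⇒Sep₃ k u _ _ _ (inj₁ e) (ahead {q} _) = inj₂ (suc k + q , trans e (identity k q) , m≤m+n (suc k) q)
  where
  identity : ∀ k q → suc (4 * k + 4) + q * 4 ≡ 1 + (suc k + q) * 4
  identity = ℕ-Solver.solve-∀
separating⇒Sep₃ k u _ u<N _ (inj₁ e) (behind {q} k<q) with m≤n⇒∃[o]m+o≡n k<q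
... | j , refl = ⊥-elim (u≢N+c u k (4 + j * 4) u<N (trans e (identity k j)))
  where
  identity : ∀ k j → suc (4 * k + 4) + (2 + (suc k + j) * 4) ≡ 7 + 8 * k + (4 + j * 4)
  identity = ℕ-Solver.solve-∀
separating⇒Sep₃ k u _ _ _ (inj₂ e) (ahead {q} q≤k) with m≤n⇒∃[o]m+o≡n q≤k
... | i , refl = ⊥-elim (u+N≢c u (q + i) _ (<-witness (1 + 4 * i) (identity q i)) e)
  where
  identity : ∀ q i → suc (suc (4 * (q + i) + 4) + q * 4) + (1 + 4 * i) ≡ 7 + 8 * (q + i)
  identity = ℕ-Solver.solve-∀
separating⇒Sep₃ k u _ _ δ<N (inj₂ e) (behind {q} _) = from-wrap u (wrap-view k u) (trans e (identity k q))
  where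
  identity : ∀ k q → suc (4 * k + 4) + (2 + q * 4) ≡ 3 + (suc k + q) * 4
  identity = ℕ-Solver.solve-∀
  M = suc k + q
  from-wrap : ∀ u → WrapView k u → u + N k ≡ 3 + M * 4 → Sep₃ k u
  from-wrap _ (wrap1 t e₀) e with () ← proj₁ (mod4-unique 0 3 (t + (2 + 2 * k)) M (trans (sym e₀) e))
  from-wrap _ (wrap2 t e₀) e with () ← proj₁ (mod4-unique 1 3 (t + (2 + 2 * k)) M (trans (sym e₀) e))
  from-wrap _ (wrap3 t e₀) e with () ← proj₁ (mod4-unique 2 3 (t + (2 + 2 * k)) M (trans (sym e₀) e))
  from-wrap _ (wrap0 t e₀) e = inj₁ (t , refl , +-cancelʳ-≤ (1 + 2 * k) t (suc k)
                                 (≤-trans (≤-reflexive t+1+2k≡M) (+-monoʳ-≤ (suc k) (2+q*4<N⇒q≤1+2k k q δ<N))))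
    where
    t+1+2k≡M : t + (1 + 2 * k) ≡ M
    t+1+2k≡M = proj₂ (mod4-unique 3 3 (t + (1 + 2 * k)) M (trans (sym e₀) e))

separating⇒Sep₄ : ∀ k ℓ u δ → u < N k →
                  (u ≡ suc (4 * (k + ℓ) + 7) + δ ⊎ u + N k ≡ suc (4 * (k + ℓ) + 7) + δ) →
                  Separating k δ → Sep₄ k ℓ u
separating⇒Sep₄ k ℓ u _ _ (inj₁ e) (ahead {q} _) = inj₁ (suc (suc k) + (ℓ + q) , trans e (identity k ℓ q) , m≤m+n _ _)
  where
  identity : ∀ k ℓ q → suc (4 * (k + ℓ) + 7) + q * 4 ≡ (suc (suc k) + (ℓ + q)) * 4
  identity = ℕ-Solver.solve-∀
separating⇒Sep₄ k ℓ u _ u<N (inj₁ e) (behind {q} k<q) with m≤n⇒∃[o]m+o≡n k<q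
... | j , refl = ⊥-elim (u≢N+c u k (7 + ℓ * 4 + j * 4) u<N (trans e (identity k ℓ j)))
  where
  identity : ∀ k ℓ j → suc (4 * (k + ℓ) + 7) + (2 + (suc k + j) * 4) ≡ 7 + 8 * k + (7 + ℓ * 4 + j * 4)
  identity = ℕ-Solver.solve-∀
separating⇒Sep₄ k ℓ u _ _ (inj₂ e) (ahead {q} q≤k) with m≤n⇒∃[o]m+o≡n q≤k
... | i , refl = from-wrap u (wrap-view (q + i) u) (trans e (identity q i ℓ))
  where
  identity : ∀ q i ℓ → suc (4 * ((q + i) + ℓ) + 7) + q * 4 ≡ 0 + (2 + (q + i) + (ℓ + q)) * 4
  identity = ℕ-Solver.solve-∀
  M = 2 + (q + i) + (ℓ + q)
  regroupˡ : ∀ t q i → t + (2 + 2 * (q + i)) ≡ (2 + 2 * q + i) + (t + i)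
  regroupˡ = ℕ-Solver.solve-∀
  regroupʳ : ∀ ℓ q i → 2 + (q + i) + (ℓ + q) ≡ (2 + 2 * q + i) + ℓ
  regroupʳ = ℕ-Solver.solve-∀
  from-wrap : ∀ u → WrapView (q + i) u → u + N (q + i) ≡ 0 + M * 4 → Sep₄ (q + i) ℓ u
  from-wrap _ (wrap0 t e₀) e with () ← proj₁ (mod4-unique 3 0 (t + (1 + 2 * (q + i))) M (trans (sym e₀) e))
  from-wrap _ (wrap2 t e₀) e with () ← proj₁ (mod4-unique 1 0 (t + (2 + 2 * (q + i))) M (trans (sym e₀) e))
  from-wrap _ (wrap3 t e₀) e with () ← proj₁ (mod4-unique 2 0 (t + (2 + 2 * (q + i))) M (trans (sym e₀) e))
  from-wrap _ (wrap1 t e₀) e = inj₂ (inj₁ (t , refl , ≤-witness i (+-cancelˡ-≡ (2 + 2 * q + i) _ _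
                                 (trans (sym (regroupˡ t q i)) (trans t+2+2k≡M (regroupʳ ℓ q i))))))
    where
    t+2+2k≡M : t + (2 + 2 * (q + i)) ≡ M
    t+2+2k≡M = proj₂ (mod4-unique 0 0 (t + (2 + 2 * (q + i))) M (trans (sym e₀) e))
separating⇒Sep₄ k ℓ u _ _ (inj₂ e) (behind {q} _) = from-wrap u (wrap-view k u) (trans e (identity k ℓ q))
  where
  identity : ∀ k ℓ q → suc (4 * (k + ℓ) + 7) + (2 + q * 4) ≡ 2 + (2 + k + (ℓ + q)) * 4
  identity = ℕ-Solver.solve-∀
  M = 2 + k + (ℓ + q)
  from-wrap : ∀ u → WrapView k u → u + N k ≡ 2 + M * 4 → Sep₄ k ℓ u
  from-wrap _ (wrap0 t e₀) e with () ← proj₁ (mod4-unique 3 2 (t + (1 + 2 * k)) M (trans (sym e₀) e))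
  from-wrap _ (wrap1 t e₀) e with () ← proj₁ (mod4-unique 0 2 (t + (2 + 2 * k)) M (trans (sym e₀) e))
  from-wrap _ (wrap2 t e₀) e with () ← proj₁ (mod4-unique 1 2 (t + (2 + 2 * k)) M (trans (sym e₀) e))
  from-wrap _ (wrap3 t e₀) e = inj₂ (inj₂ (t , refl))

Sep₁∩Sep₂ : ∀ {k u} → Sep₁ k u → Sep₂ u → ∃ λ q → u ≡ 2 + q * 4 × q ≤ k
Sep₁∩Sep₂ (inj₁ refl) (inj₁ (q , e)) with () ← proj₁ (mod4-unique 1 2 0 q e)
Sep₁∩Sep₂ (inj₁ refl) (inj₂ (q , e)) with () ← proj₁ (mod4-unique 1 3 0 q e)
Sep₁∩Sep₂ (inj₂ (inj₁ two-mod-4)) _ = two-mod-4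
Sep₁∩Sep₂ (inj₂ (inj₂ (q , refl , _))) (inj₁ (q' , e)) with () ← proj₁ (mod4-unique 0 2 q q' e)
Sep₁∩Sep₂ (inj₂ (inj₂ (q , refl , _))) (inj₂ (q' , e)) with () ← proj₁ (mod4-unique 0 3 q q' e)

Sep₁∩Sep₃=∅ : ∀ {k u} → Sep₁ k u → Sep₃ k u → ⊥
Sep₁∩Sep₃=∅ (inj₁ refl) (inj₁ (q' , e , _)) with () ← proj₁ (mod4-unique 1 0 0 q' e)
Sep₁∩Sep₃=∅ (inj₁ refl) (inj₂ (q' , e , k<q')) with refl ← proj₂ (mod4-unique 1 1 0 q' e) with () ← k<q'
Sep₁∩Sep₃=∅ (inj₂ (inj₁ (q , refl , _))) (inj₁ (q' , e , _)) with () ← proj₁ (mod4-unique 2 0 q q' e)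
Sep₁∩Sep₃=∅ (inj₂ (inj₁ (q , refl , _))) (inj₂ (q' , e , _)) with () ← proj₁ (mod4-unique 2 1 q q' e)
Sep₁∩Sep₃=∅ (inj₂ (inj₂ (q , refl , k+1<q))) (inj₁ (q' , e , q'≤k+1)) with refl ← proj₂ (mod4-unique 0 0 q q' e) =
  <-irrefl refl (≤-trans k+1<q q'≤k+1)
Sep₁∩Sep₃=∅ (inj₂ (inj₂ (q , refl , _))) (inj₂ (q' , e , _)) with () ← proj₁ (mod4-unique 0 1 q q' e)

Sep₂∩Sep₃=∅ : ∀ {k u} → Sep₂ u → Sep₃ k u → ⊥
Sep₂∩Sep₃=∅ (inj₁ (q , refl)) (inj₁ (q' , e , _)) with () ← proj₁ (mod4-unique 2 0 q q' e)
Sep₂∩Sep₃=∅ (inj₁ (q , refl)) (inj₂ (q' , e , _)) with () ← proj₁ (mod4-unique 2 1 q q' e)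
Sep₂∩Sep₃=∅ (inj₂ (q , refl)) (inj₁ (q' , e , _)) with () ← proj₁ (mod4-unique 3 0 q q' e)
Sep₂∩Sep₃=∅ (inj₂ (q , refl)) (inj₂ (q' , e , _)) with () ← proj₁ (mod4-unique 3 1 q q' e)

Sep₄-≢2-mod-4 : ∀ {k ℓ} q → Sep₄ k ℓ (2 + q * 4) → ⊥
Sep₄-≢2-mod-4 q (inj₁ (q' , e , _)) with () ← proj₁ (mod4-unique 2 0 q q' e)
Sep₄-≢2-mod-4 q (inj₂ (inj₁ (q' , e , _))) with () ← proj₁ (mod4-unique 2 1 q q' e)
Sep₄-≢2-mod-4 q (inj₂ (inj₂ (q' , e))) with () ← proj₁ (mod4-unique 2 3 q q' e)

Sep₃∩Sep₄=∅ : ∀ {k ℓ u} → ℓ < k → Sep₃ k u → Sep₄ k ℓ u → ⊥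
Sep₃∩Sep₄=∅ _ (inj₁ (q , refl , q≤k+1)) (inj₁ (q' , e , k+1<q')) with refl ← proj₂ (mod4-unique 0 0 q q' e) =
  <-irrefl refl (≤-trans k+1<q' q≤k+1)
Sep₃∩Sep₄=∅ _ (inj₁ (q , refl , _)) (inj₂ (inj₁ (q' , e , _))) with () ← proj₁ (mod4-unique 0 1 q q' e)
Sep₃∩Sep₄=∅ _ (inj₁ (q , refl , _)) (inj₂ (inj₂ (q' , e))) with () ← proj₁ (mod4-unique 0 3 q q' e)
Sep₃∩Sep₄=∅ _ (inj₂ (q , refl , _)) (inj₁ (q' , e , _)) with () ← proj₁ (mod4-unique 1 0 q q' e)
Sep₃∩Sep₄=∅ ℓ<k (inj₂ (q , refl , k<q)) (inj₂ (inj₁ (q' , e , q'≤ℓ))) with refl ← proj₂ (mod4-unique 1 1 q q' e) =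
  <-irrefl refl (≤-trans k<q (≤-trans q'≤ℓ (<⇒≤ ℓ<k)))
Sep₃∩Sep₄=∅ _ (inj₂ (q , refl , _)) (inj₂ (inj₂ (q' , e))) with () ← proj₁ (mod4-unique 1 3 q q' e)

3≤∣p∣ : ∀ {m} {p : Subset m} {x y z} → x ≢ y → x ≢ z → y ≢ z → x ∈ p → y ∈ p → z ∈ p → 3 ≤ ∣ p ∣
3≤∣p∣ x≢y x≢z y≢z x∈p y∈p z∈p =
  ≤-trans (s≤s (≤-trans (s≤s (≤-trans (s≤s z≤n) (x∈p⇒∣p-x∣<∣p∣ z∈p-x-y)))
                        (x∈p⇒∣p-x∣<∣p∣ y∈p-x)))
          (x∈p⇒∣p-x∣<∣p∣ x∈p)
  where
  y∈p-x = x∈p∧x≢y⇒x∈p-y y∈p (≢-sym x≢y)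
  z∈p-x-y = x∈p∧x≢y⇒x∈p-y (x∈p∧x≢y⇒x∈p-y z∈p (≢-sym x≢z)) (≢-sym y≢z)

pair₂-< : ∀ k → suc (4 * k + 2) < N k
pair₂-< k = <-witness (3 + 4 * k) (identity k)
  where
  identity : ∀ k → 1 + (1 + (4 * k + 2)) + (3 + 4 * k) ≡ 7 + 8 * k
  identity = ℕ-Solver.solve-∀

pair₃-< : ∀ k → suc (4 * k + 4) < N k
pair₃-< k = <-witness (1 + 4 * k) (identity k)
  where
  identity : ∀ k → 1 + (1 + (4 * k + 4)) + (1 + 4 * k) ≡ 7 + 8 * k
  identity = ℕ-Solver.solve-∀

pair₄-< : ∀ k ℓ → ℓ < k → suc (4 * (k + ℓ) + 7) < N k
pair₄-< k ℓ ℓ<k with m≤n⇒∃[o]m+o≡n ℓ<k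
... | i , 1+ℓ+i≡k = subst (λ k → suc (4 * (k + ℓ) + 7) < N k) 1+ℓ+i≡k (<-witness (2 + 4 * i) (identity ℓ i))
  where
  identity : ∀ ℓ i → 1 + (1 + (4 * ((1 + ℓ + i) + ℓ) + 7)) + (2 + 4 * i) ≡ 7 + 8 * (1 + ℓ + i)
  identity = ℕ-Solver.solve-∀

module Separators (k ℓ : ℕ) (X : Subset (N k)) (resolves : Resolves (N k) X (clusterA k ℓ)) where
  open Circulant (N k)

  private
    separator-of : ∀ j {a b} → vtx (N k) a List.∈ clusterA k ℓ j → vtx (N k) b List.∈ clusterA k ℓ j →
                   b ≡ suc a → suc a < N k → ¬ ¬ Separator k X a
    separator-of j a∈A b∈A refl a+1<N = separator k X _ a+1<N (resolves j _ _ a∈A b∈A (v≢v-suc a+1<N))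

  separator₁ : ¬ ¬ (∃ λ x → x ∈ X × Sep₁ k (toℕ x))
  separator₁ = ¬¬-map (λ (x , x∈X , δ , δ<N , x≡ , s) →
                         x , x∈X , separating⇒Sep₁ k (toℕ x) δ δ<N x≡ s)
                 (separator-of fzero (here refl) (there (here refl)) refl (s≤s (s≤s (s≤s z≤n))))

  separator₂ : ¬ ¬ (∃ λ x → x ∈ X × Sep₂ (toℕ x))
  separator₂ = ¬¬-map (λ (x , x∈X , δ , _ , x≡ , s) →
                         x , x∈X , separating⇒Sep₂ k (toℕ x) δ (toℕ<n x) x≡ s)
                 (separator-of (fsuc fzero) (here refl) (there (here refl)) (+-suc (4 * k) 2) (pair₂-< k))

  separator₃ : ¬ ¬ (∃ λ x → x ∈ X × Sep₃ k (toℕ x))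
  separator₃ = ¬¬-map (λ (x , x∈X , δ , δ<N , x≡ , s) →
                         x , x∈X , separating⇒Sep₃ k (toℕ x) δ (toℕ<n x) δ<N x≡ s)
                 (separator-of (fsuc (fsuc fzero)) (here refl) (there (here refl)) (+-suc (4 * k) 4) (pair₃-< k))

  separator₄ : ℓ < k → ¬ ¬ (∃ λ x → x ∈ X × Sep₄ k ℓ (toℕ x))
  separator₄ ℓ<k = ¬¬-map (λ (x , x∈X , δ , _ , x≡ , s) →
                             x , x∈X , separating⇒Sep₄ k ℓ (toℕ x) δ (toℕ<n x) x≡ s)
                     (separator-of (fsuc (fsuc (fsuc fzero))) (here refl) (there (here refl))
                        (+-suc (4 * (k + ℓ)) 7) (pair₄-< k ℓ ℓ<k))

lemma3p12 : (k ℓ : ℕ) → 1 ≤ k → ℓ ≤ k →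
    (∃ λ (S : Subset (N k)) → IsCluster (N k) S (clusterA k ℓ)) →
    (X : Subset (N k)) →
    (∀ t → t ≤ ℓ → vtx (N k) (2 + 4 * t) ∉ X) →
    Resolves (N k) X (clusterA k ℓ) →
    3 ≤ ∣ X ∣
lemma3p12 k ℓ _ _ _ X forbidden resolves = decidable-stable (3 ≤? ∣ X ∣) do
  x₁ , x₁∈X , L₁ ← separator₁
  x₂ , x₂∈X , L₂ ← separator₂
  x₃ , x₃∈X , L₃ ← separator₃
  case x₁ ≟ᶠ x₂ of λ where
    (no x₁≢x₂) → pure (3≤∣p∣ x₁≢x₂ (λ { refl → Sep₁∩Sep₃=∅ L₁ L₃ })
                             (λ { refl → Sep₂∩Sep₃=∅ L₂ L₃ }) x₁∈X x₂∈X x₃∈X)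
    (yes refl) → let q , x₁≡2+4q , q≤k = Sep₁∩Sep₂ L₁ L₂ in case q ≤? ℓ of λ where
      (yes q≤ℓ) → ⊥-elim (forbidden q q≤ℓ (subst (_∈ X) (sym (vtx-2+4q q x₁≡2+4q)) x₁∈X))
      (no q≰ℓ) → do
        let ℓ<k = <-≤-trans (≰⇒> q≰ℓ) q≤k
        x₄ , x₄∈X , L₄ ← separator₄ ℓ<k
        pure (3≤∣p∣ (λ { refl → Sep₂∩Sep₃=∅ L₂ L₃ })
                    (λ { refl → Sep₄-≢2-mod-4 q (subst (Sep₄ k ℓ) x₁≡2+4q L₄) })
                    (λ { refl → Sep₃∩Sep₄=∅ ℓ<k L₃ L₄ }) x₁∈X x₃∈X x₄∈X)
  where
  open Circulant (N k)
  open Separators k ℓ X resolves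
  open RawMonad (¬¬-Monad {0ℓ})
  vtx-2+4q : ∀ {x} q → toℕ x ≡ 2 + q * 4 → vtx (N k) (2 + 4 * q) ≡ x
  vtx-2+4q q x≡ = trans (cong (λ t → v (2 + t)) (*-comm 4 q)) (Names⇒v≡ (inj₁ x≡))
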